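{- Let $\mathcal{G}$ be a $d$-uniform hypergraph, and let $P$ be a perfect coloring of $\mathcal{G}$ into $k$ colors with parameter matrix $\mathbb{S}$. Let $N=P^TP$. Then the $d$-dimensional matrix $\mathbb{H}=N\circ\mathbb{S}$, with entries $$h_\beta=\sum_{j=1}^k n_{\beta_1,j}\,s_{j,\beta_2,\dots,\beta_d},$$ is symmetric.
   Context: A $d$-uniform hypergraph on vertex set $[n]$ has $d$-element hyperedges. Its adjacency matrix $\mathbb{A}$ is the $d$-dimensional array with $a_{(x_1,\dots,x_d)}=1/(d-1)!$ if $\{x_1,\dots,x_d\}$ is a hyperedge, and $0$ otherwise. A coloring is a surjective map $f:[n]\to[k]$ with color matrix $P$ ($n\times k$, $p_{x,i}=1$ iff $f(x)=i$); thus $N=P^TP$ is diagonal with $i$-th diagonal entry equal to the number of vertices of color $i$. We use $$(\mathbb{A}\circ P)_{x,j_1,\dots,j_{d-1}}=\sum_{x_1,\dots,x_{d-1}}a_{x,x_1,\dots,x_{d-1}}p_{x_1,j_1}\cdots p_{x_{d-1},j_{d-1}},\qquad (P\circ\mathbb{S})_{x,\beta}=\sum_ip_{x,i}s_{i,\beta}.$$ The coloring is perfect if there is a $d$-dimensional $\mathbb{S}$ of order $k$ with $\mathbb{A}\circ P=P\circ\mathbb{S}$ (equivalently, all vertices of the same color lie in equally many hyperedges of each color range); this $\mathbb{S}$ is unique and is the parameter matrix. A $d$-dimensional matrix $\mathbb{H}$ is symmetric if $h_\alpha=h_{(\alpha_{\sigma(1)},\dots,\alpha_{\sigma(d)})}$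 for all indices $\alpha$ and all permutations $\sigma\in S_d$. -}

module Defs where

open import Data.Nat using (ℕ; zero; suc; _!)
open import Data.Nat.Properties using (_!≢0)
open import Data.Integer using (+_)
open import Data.Bool using (Bool; true; false; T; if_then_else_)
open import Data.Fin using (Fin; zero; suc; _≟_)
open import Data.Fin.Subset using (Subset; ∣_∣)
open import Data.Vec using (tabulate)
open import Data.Vec.Functional using (_∷_; tail)
open import Data.Rational using (ℚ; _/_; _+_; _*_; 0ℚ; 1ℚ)
open import Data.Product using (Σ; ∃; _,_)
open import Relation.Binary.PropositionalEquality using (_≡_)
open import Relation.Nullary.Decidable using (⌊_⌋)

anyFin : ∀ {m} → (Fin m → Bool) → Bool
anyFin {zero} f = false
anyFin {suc m} f with f zero
... | true = true
... | false = anyFin (λ i → f (suc i))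

sumFin : ∀ {m} → (Fin m → ℚ) → ℚ
sumFin {zero} f = 0ℚ
sumFin {suc m} f = f zero + sumFin (λ i → f (suc i))

prodFin : ∀ {m} → (Fin m → ℚ) → ℚ
prodFin {zero} f = 1ℚ
prodFin {suc m} f = f zero * prodFin (λ i → f (suc i))

sumIdx : ∀ m {n} → ((Fin m → Fin n) → ℚ) → ℚ
sumIdx zero F = F (λ ())
sumIdx (suc m) F = sumFin (λ i → sumIdx m (λ xs → F (i ∷ xs)))

record Hypergraph (d n : ℕ) : Set where
  field
    isEdge  : Subset n → Bool
    uniform : ∀ e → T (isEdge e) → ∣ e ∣ ≡ d
open Hypergraph public

image : ∀ {d n} → (Fin d → Fin n) → Subset n
image x = tabulate (λ v → anyFin (λ i → ⌊ x i ≟ v ⌋))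

-- adjacency array of a d-uniform hypergraph, d = suc m:
-- a_{x_1…x_d} = 1/(d-1)! if {x_1,…,x_d} is a hyperedge, else 0
adj : ∀ {m n} → Hypergraph (suc m) n → (Fin (suc m) → Fin n) → ℚ
adj {m} G x = if isEdge G (image x) then ((+ 1) / (m !)) {{m !≢0}} else 0ℚ

Surjective : ∀ {n k} → (Fin n → Fin k) → Set
Surjective {n} {k} f = ∀ (i : Fin k) → ∃ λ (x : Fin n) → f x ≡ i

colorMatrix : ∀ {n k} → (Fin n → Fin k) → Fin n → Fin k → ℚ
colorMatrix f x i = if ⌊ f x ≟ i ⌋ then 1ℚ else 0ℚ

NMatrix : ∀ {n k} → (Fin n → Fin k) → Fin k → Fin k → ℚ
NMatrix f i j = sumFin (λ x → colorMatrix f x i * colorMatrix f x j)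

adjCompP : ∀ {m n k} → Hypergraph (suc m) n → (Fin n → Fin k)
         → Fin n → (Fin m → Fin k) → ℚ
adjCompP {m} G f x js =
  sumIdx m (λ xs → adj G (x ∷ xs) * prodFin (λ l → colorMatrix f (xs l) (js l)))

PCompS : ∀ {m n k} → (Fin n → Fin k) → ((Fin (suc m) → Fin k) → ℚ)
       → Fin n → (Fin m → Fin k) → ℚ
PCompS f S x β = sumFin (λ i → colorMatrix f x i * S (i ∷ β))

-- S is the parameter matrix of the (perfect) coloring f: A ∘ P = P ∘ S
IsParameterMatrix : ∀ {m n k} → Hypergraph (suc m) n → (Fin n → Fin k)
                  → ((Fin (suc m) → Fin k) → ℚ) → Set
IsParameterMatrix G f S = ∀ x js → adjCompP G f x js ≡ PCompS f S x js

NCompS : ∀ {m k} → (Fin k → Fin k → ℚ) → ((Fin (suc m) → Fin k) → ℚ)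
       → (Fin (suc m) → Fin k) → ℚ
NCompS N S β = sumFin (λ j → N (β zero) j * S (j ∷ tail β))

-- Both sides of the symmetry equal the full contraction
--   Σ_{x ∈ [n]^d} a_x · Π_l p_{x_l, β_l}
-- of the adjacency array with the color matrix in every index: summing the
-- identity A ∘ P = P ∘ S against the column β₁ of P turns N ∘ S into it.
-- The contraction is symmetric in β because a_x depends only on the set
-- {x_1,…,x_d}, so permuting β can be undone by reindexing the sum over x.
module Submission where

open import Defs
open import Data.Nat using (ℕ; zero; suc)
open import Data.Bool using (Bool; true; false; if_then_else_)
open import Data.Bool.Properties using (∨-commutativeMonoid)
open import Data.Fin using (Fin; zero; suc; punchIn; punchOut; _≟_)
open import Data.Fin.Properties using (punchIn-punchOut)
open import Data.Fin.Permutation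
  using (Permutation′; _⟨$⟩ʳ_; _⟨$⟩ˡ_; remove; flip; inverseʳ; inverseˡ; punchIn-permute′)
open import Data.Vec.Properties using (tabulate-cong)
open import Data.Vec.Functional using (insertAt; _∷_; tail)
open import Data.Vec.Functional.Properties using (∷-cong; insertAt-lookup; insertAt-punchIn)
open import Data.Rational using (ℚ; _+_; _*_; 0ℚ)
open import Data.Rational.Properties
  using (+-*-commutativeRing; *-1-commutativeMonoid; *-assoc)
open import Algebra.Bundles using (CommutativeRing; CommutativeMonoid)
open import Relation.Binary.Core using (_Preserves_⟶_)
open import Relation.Binary.PropositionalEquality
  using (_≡_; _≗_; refl; sym; trans; cong; cong₂; module ≡-Reasoning)
open import Relation.Nullary using (yes; no)
open import Relation.Nullary.Decidable using (⌊_⌋)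
import Algebra.Properties.Semiring.Sum as SemiringSum
import Algebra.Properties.CommutativeMonoid.Sum as CommutativeMonoidSum
open import Algebra.Properties.CommutativeSemigroup
  (CommutativeMonoid.commutativeSemigroup *-1-commutativeMonoid) using (x∙yz≈y∙xz)

open ≡-Reasoning

module ℚ-Sum = SemiringSum (CommutativeRing.semiring +-*-commutativeRing)
module ℚ-Product = CommutativeMonoidSum *-1-commutativeMonoid
module Bool-Any = CommutativeMonoidSum ∨-commutativeMonoid

sumFin≡sum : ∀ {m} (f : Fin m → ℚ) → sumFin f ≡ ℚ-Sum.sum f
sumFin≡sum {zero}  f = refl
sumFin≡sum {suc m} f = cong (f zero +_) (sumFin≡sum (λ i → f (suc i)))

prodFin≡product : ∀ {m} (f : Fin m → ℚ) → prodFin f ≡ ℚ-Product.sum f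
prodFin≡product {zero}  f = refl
prodFin≡product {suc m} f = cong (f zero *_) (prodFin≡product (λ i → f (suc i)))

anyFin≡or : ∀ {m} (f : Fin m → Bool) → anyFin f ≡ Bool-Any.sum f
anyFin≡or {zero}  f = refl
anyFin≡or {suc m} f with f zero
... | true  = refl
... | false = anyFin≡or (λ i → f (suc i))

sumFin-cong : ∀ {m} {f g : Fin m → ℚ} → f ≗ g → sumFin f ≡ sumFin g
sumFin-cong {zero}  f≗g = refl
sumFin-cong {suc m} f≗g = cong₂ _+_ (f≗g zero) (sumFin-cong (λ i → f≗g (suc i)))

prodFin-cong : ∀ {m} {f g : Fin m → ℚ} → f ≗ g → prodFin f ≡ prodFin g
prodFin-cong {zero}  f≗g = refl
prodFin-cong {suc m} f≗g = cong₂ _*_ (f≗g zero) (prodFin-cong (λ i → f≗g (suc i)))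

anyFin-cong : ∀ {m} {f g : Fin m → Bool} → f ≗ g → anyFin f ≡ anyFin g
anyFin-cong {f = f} {g} f≗g = begin
  anyFin f       ≡⟨ anyFin≡or f ⟩
  Bool-Any.sum f ≡⟨ Bool-Any.sum-cong-≗ f≗g ⟩
  Bool-Any.sum g ≡⟨ anyFin≡or g ⟨
  anyFin g       ∎

anyFin-permute : ∀ {m} (f : Fin m → Bool) (π : Permutation′ m) →
                 anyFin (λ i → f (π ⟨$⟩ʳ i)) ≡ anyFin f
anyFin-permute f π = begin
  anyFin (λ i → f (π ⟨$⟩ʳ i))       ≡⟨ anyFin≡or (λ i → f (π ⟨$⟩ʳ i)) ⟩
  Bool-Any.sum (λ i → f (π ⟨$⟩ʳ i)) ≡⟨ Bool-Any.sum-permute f π ⟨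
  Bool-Any.sum f                     ≡⟨ anyFin≡or f ⟨
  anyFin f                           ∎

prodFin-permute : ∀ {m} (f : Fin m → ℚ) (π : Permutation′ m) →
                  prodFin f ≡ prodFin (λ i → f (π ⟨$⟩ʳ i))
prodFin-permute f π = begin
  prodFin f                              ≡⟨ prodFin≡product f ⟩
  ℚ-Product.sum f                        ≡⟨ ℚ-Product.sum-permute f π ⟩
  ℚ-Product.sum (λ i → f (π ⟨$⟩ʳ i))    ≡⟨ prodFin≡product (λ i → f (π ⟨$⟩ʳ i)) ⟨
  prodFin (λ i → f (π ⟨$⟩ʳ i))          ∎

sumFin-comm : ∀ {a b} (F : Fin a → Fin b → ℚ) →
              sumFin (λ i → sumFin (F i)) ≡ sumFin (λ j → sumFin (λ i → F i j))
sumFin-comm F = begin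
  sumFin (λ i → sumFin (F i))
    ≡⟨ sumFin-cong (λ i → sumFin≡sum (F i)) ⟩
  sumFin (λ i → ℚ-Sum.sum (F i))
    ≡⟨ sumFin≡sum (λ i → ℚ-Sum.sum (F i)) ⟩
  ℚ-Sum.sum (λ i → ℚ-Sum.sum (F i))
    ≡⟨ ℚ-Sum.∑-comm F ⟩
  ℚ-Sum.sum (λ j → ℚ-Sum.sum (λ i → F i j))
    ≡⟨ sumFin≡sum (λ j → ℚ-Sum.sum (λ i → F i j)) ⟨
  sumFin (λ j → ℚ-Sum.sum (λ i → F i j))
    ≡⟨ sumFin-cong (λ j → sumFin≡sum (λ i → F i j)) ⟨
  sumFin (λ j → sumFin (λ i → F i j)) ∎

*-distribˡ-sumFin : ∀ {m} c (f : Fin m → ℚ) → c * sumFin f ≡ sumFin (λ i → c * f i)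
*-distribˡ-sumFin c f = begin
  c * sumFin f                     ≡⟨ cong (c *_) (sumFin≡sum f) ⟩
  c * ℚ-Sum.sum f                  ≡⟨ ℚ-Sum.*-distribˡ-sum c f ⟩
  ℚ-Sum.sum (λ i → c * f i)        ≡⟨ sumFin≡sum (λ i → c * f i) ⟨
  sumFin (λ i → c * f i)           ∎

*-distribʳ-sumFin : ∀ {m} c (f : Fin m → ℚ) → sumFin f * c ≡ sumFin (λ i → f i * c)
*-distribʳ-sumFin c f = begin
  sumFin f * c                     ≡⟨ cong (_* c) (sumFin≡sum f) ⟩
  ℚ-Sum.sum f * c                  ≡⟨ ℚ-Sum.*-distribʳ-sum c f ⟩
  ℚ-Sum.sum (λ i → f i * c)        ≡⟨ sumFin≡sum (λ i → f i * c) ⟨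
  sumFin (λ i → f i * c)           ∎

sumIdx-cong : ∀ m {n} {F G : (Fin m → Fin n) → ℚ} → F ≗ G → sumIdx m F ≡ sumIdx m G
sumIdx-cong zero    F≗G = F≗G _
sumIdx-cong (suc m) F≗G = sumFin-cong (λ i → sumIdx-cong m (λ xs → F≗G (i ∷ xs)))

*-distribˡ-sumIdx : ∀ m {n} c (F : (Fin m → Fin n) → ℚ) →
                    c * sumIdx m F ≡ sumIdx m (λ xs → c * F xs)
*-distribˡ-sumIdx zero    c F = refl
*-distribˡ-sumIdx (suc m) c F = begin
  c * sumFin (λ i → sumIdx m (λ xs → F (i ∷ xs)))
    ≡⟨ *-distribˡ-sumFin c (λ i → sumIdx m (λ xs → F (i ∷ xs))) ⟩
  sumFin (λ i → c * sumIdx m (λ xs → F (i ∷ xs)))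
    ≡⟨ sumFin-cong (λ i → *-distribˡ-sumIdx m c (λ xs → F (i ∷ xs))) ⟩
  sumFin (λ i → sumIdx m (λ xs → c * F (i ∷ xs))) ∎

insertAt-cong : ∀ {m} {A : Set} {xs ys : Fin m → A} (p : Fin (suc m)) (v : A) →
                xs ≗ ys → insertAt xs p v ≗ insertAt ys p v
insertAt-cong         zero    v xs≗ys zero    = refl
insertAt-cong         zero    v xs≗ys (suc l) = xs≗ys l
insertAt-cong {suc m} (suc p) v xs≗ys zero    = xs≗ys zero
insertAt-cong {suc m} (suc p) v xs≗ys (suc l) = insertAt-cong p v (λ i → xs≗ys (suc i)) l

∷-insertAt-zero : ∀ {m} {A : Set} (v : A) (xs : Fin m → A) → v ∷ xs ≗ insertAt xs zero v
∷-insertAt-zero v xs zero    = refl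
∷-insertAt-zero v xs (suc l) = refl

∷-insertAt : ∀ {m} {A : Set} (j : A) (xs : Fin m → A) (p : Fin (suc m)) (v : A) →
             j ∷ insertAt xs p v ≗ insertAt (j ∷ xs) (suc p) v
∷-insertAt j xs p v zero    = refl
∷-insertAt j xs p v (suc l) = refl

sumIdx-insertAt : ∀ m {n} (p : Fin (suc m)) (F : (Fin (suc m) → Fin n) → ℚ) →
                  F Preserves _≗_ ⟶ _≡_ →
                  sumIdx (suc m) F ≡ sumFin (λ i → sumIdx m (λ xs → F (insertAt xs p i)))
sumIdx-insertAt m zero F F-cong =
  sumFin-cong (λ i → sumIdx-cong m (λ xs → F-cong (∷-insertAt-zero i xs)))
sumIdx-insertAt (suc m) (suc p) F F-cong = begin
  sumFin (λ j → sumIdx (suc m) (λ ys → F (j ∷ ys)))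
    ≡⟨ sumFin-cong (λ j → sumIdx-insertAt m p (λ ys → F (j ∷ ys))
         (λ ys≗zs → F-cong (∷-cong refl ys≗zs))) ⟩
  sumFin (λ j → sumFin (λ i → sumIdx m (λ xs → F (j ∷ insertAt xs p i))))
    ≡⟨ sumFin-comm (λ j i → sumIdx m (λ xs → F (j ∷ insertAt xs p i))) ⟩
  sumFin (λ i → sumFin (λ j → sumIdx m (λ xs → F (j ∷ insertAt xs p i))))
    ≡⟨ sumFin-cong (λ i → sumFin-cong (λ j → sumIdx-cong m (λ xs →
         F-cong (∷-insertAt j xs p i)))) ⟩
  sumFin (λ i → sumIdx (suc m) (λ xs → F (insertAt xs (suc p) i))) ∎

∷-permute : ∀ {m} {A : Set} (σ : Permutation′ (suc m)) (i : A) (xs : Fin m → A) →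
            (λ l → (i ∷ xs) (σ ⟨$⟩ʳ l)) ≗
            insertAt (λ l → xs (remove (σ ⟨$⟩ˡ zero) σ ⟨$⟩ʳ l)) (σ ⟨$⟩ˡ zero) i
∷-permute σ i xs l with l ≟ σ ⟨$⟩ˡ zero
... | yes refl = trans (cong (i ∷ xs) (inverseʳ σ)) (sym (insertAt-lookup _ (σ ⟨$⟩ˡ zero) i))
... | no l≢q = begin
  (i ∷ xs) (σ ⟨$⟩ʳ l)
    ≡⟨ cong (λ t → (i ∷ xs) (σ ⟨$⟩ʳ t)) (punchIn-punchOut q≢l) ⟨
  (i ∷ xs) (σ ⟨$⟩ʳ punchIn q l′)
    ≡⟨ cong (i ∷ xs) (punchIn-permute′ σ zero l′) ⟩
  xs (τ ⟨$⟩ʳ l′)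
    ≡⟨ insertAt-punchIn (λ l → xs (τ ⟨$⟩ʳ l)) q i l′ ⟨
  insertAt (λ l → xs (τ ⟨$⟩ʳ l)) q i (punchIn q l′)
    ≡⟨ cong (insertAt (λ l → xs (τ ⟨$⟩ʳ l)) q i) (punchIn-punchOut q≢l) ⟩
  insertAt (λ l → xs (τ ⟨$⟩ʳ l)) q i l ∎
  where
  q = σ ⟨$⟩ˡ zero
  τ = remove q σ
  q≢l = λ q≡l → l≢q (sym q≡l)
  l′ = punchOut q≢l

sumIdx-permute : ∀ m {n} (σ : Permutation′ m) (F : (Fin m → Fin n) → ℚ) →
                 F Preserves _≗_ ⟶ _≡_ →
                 sumIdx m F ≡ sumIdx m (λ xs → F (λ l → xs (σ ⟨$⟩ʳ l)))
sumIdx-permute zero    σ F F-cong = F-cong (λ ())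
sumIdx-permute (suc m) σ F F-cong = begin
  sumIdx (suc m) F
    ≡⟨ sumIdx-insertAt m q F F-cong ⟩
  sumFin (λ i → sumIdx m (λ xs → F (insertAt xs q i)))
    ≡⟨ sumFin-cong (λ i → sumIdx-permute m τ (λ xs → F (insertAt xs q i))
         (λ xs≗ys → F-cong (insertAt-cong q i xs≗ys))) ⟩
  sumFin (λ i → sumIdx m (λ xs → F (insertAt (λ l → xs (τ ⟨$⟩ʳ l)) q i)))
    ≡⟨ sumFin-cong (λ i → sumIdx-cong m (λ xs → F-cong (∷-permute σ i xs))) ⟨
  sumIdx (suc m) (λ xs → F (λ l → xs (σ ⟨$⟩ʳ l))) ∎
  where
  q = σ ⟨$⟩ˡ zero
  τ = remove q σ

image-cong : ∀ {d n} {x y : Fin d → Fin n} → x ≗ y → image x ≡ image y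
image-cong x≗y = tabulate-cong (λ v → anyFin-cong (λ i → cong (λ t → ⌊ t ≟ v ⌋) (x≗y i)))

image-permute : ∀ {d n} (x : Fin d → Fin n) (π : Permutation′ d) →
                image (λ i → x (π ⟨$⟩ʳ i)) ≡ image x
image-permute x π = tabulate-cong (λ v → anyFin-permute (λ i → ⌊ x i ≟ v ⌋) π)

adj-cong : ∀ {m n} (G : Hypergraph (suc m) n) {x y : Fin (suc m) → Fin n} →
           image x ≡ image y → adj G x ≡ adj G y
adj-cong G = cong (λ e → if isEdge G e then _ else 0ℚ)

adj-permute : ∀ {m n} (G : Hypergraph (suc m) n) (x : Fin (suc m) → Fin n) (π : Permutation′ (suc m)) →
              adj G (λ i → x (π ⟨$⟩ʳ i)) ≡ adj G x
adj-permute G x π = adj-cong G {λ i → x (π ⟨$⟩ʳ i)} {x} (image-permute x π)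

module _ {m n k : ℕ} (G : Hypergraph (suc m) n) (f : Fin n → Fin k) where

  private
    p = colorMatrix f

  colorWeight : (Fin (suc m) → Fin k) → (Fin (suc m) → Fin n) → ℚ
  colorWeight β x = prodFin (λ l → p (x l) (β l))

  adjContraction : (Fin (suc m) → Fin k) → ℚ
  adjContraction β = sumIdx (suc m) (λ x → adj G x * colorWeight β x)

  NCompS≡adjContraction : ∀ S → IsParameterMatrix G f S →
                          ∀ β → NCompS (NMatrix f) S β ≡ adjContraction β
  NCompS≡adjContraction S A∘P≡P∘S β = begin
    sumFin (λ j → NMatrix f b j * S (j ∷ tail β))
      ≡⟨ sumFin-cong (λ j → *-distribʳ-sumFin (S (j ∷ tail β)) (λ x → p x b * p x j)) ⟩
    sumFin (λ j → sumFin (λ x → p x b * p x j * S (j ∷ tail β)))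
      ≡⟨ sumFin-comm (λ j x → p x b * p x j * S (j ∷ tail β)) ⟩
    sumFin (λ x → sumFin (λ j → p x b * p x j * S (j ∷ tail β)))
      ≡⟨ sumFin-cong (λ x → sumFin-cong (λ j → *-assoc (p x b) (p x j) (S (j ∷ tail β)))) ⟩
    sumFin (λ x → sumFin (λ j → p x b * (p x j * S (j ∷ tail β))))
      ≡⟨ sumFin-cong (λ x → *-distribˡ-sumFin (p x b) (λ j → p x j * S (j ∷ tail β))) ⟨
    sumFin (λ x → p x b * PCompS f S x (tail β))
      ≡⟨ sumFin-cong (λ x → cong (p x b *_) (A∘P≡P∘S x (tail β))) ⟨
    sumFin (λ x → p x b * adjCompP G f x (tail β))
      ≡⟨ sumFin-cong (λ x → *-distribˡ-sumIdx m (p x b) (λ xs → adj G (x ∷ xs) * colors xs)) ⟩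
    sumFin (λ x → sumIdx m (λ xs → p x b * (adj G (x ∷ xs) * colors xs)))
      ≡⟨ sumFin-cong (λ x → sumIdx-cong m (λ xs → x∙yz≈y∙xz (p x b) (adj G (x ∷ xs)) (colors xs))) ⟩
    adjContraction β ∎
    where
    b = β zero
    colors : (Fin m → Fin n) → ℚ
    colors xs = prodFin (λ l → p (xs l) (tail β l))

  colorWeight-permute : ∀ β x (σ : Permutation′ (suc m)) →
                        colorWeight β (λ l → x (flip σ ⟨$⟩ʳ l)) ≡ colorWeight (λ l → β (σ ⟨$⟩ʳ l)) x
  colorWeight-permute β x σ = begin
    prodFin (λ l → p (x (flip σ ⟨$⟩ʳ l)) (β l))
      ≡⟨ prodFin-permute (λ l → p (x (flip σ ⟨$⟩ʳ l)) (β l)) σ ⟩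
    prodFin (λ l → p (x (flip σ ⟨$⟩ʳ (σ ⟨$⟩ʳ l))) (β (σ ⟨$⟩ʳ l)))
      ≡⟨ prodFin-cong (λ l → cong (λ t → p (x t) (β (σ ⟨$⟩ʳ l))) (inverseˡ σ {l})) ⟩
    prodFin (λ l → p (x l) (β (σ ⟨$⟩ʳ l))) ∎

  adjContraction-permute : ∀ β (σ : Permutation′ (suc m)) →
                           adjContraction β ≡ adjContraction (λ l → β (σ ⟨$⟩ʳ l))
  adjContraction-permute β σ = begin
    sumIdx (suc m) (λ x → adj G x * colorWeight β x)
      ≡⟨ sumIdx-permute (suc m) (flip σ) (λ x → adj G x * colorWeight β x) summand-cong ⟩
    sumIdx (suc m) (λ x → adj G (λ l → x (flip σ ⟨$⟩ʳ l)) * colorWeight β (λ l → x (flip σ ⟨$⟩ʳ l)))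
      ≡⟨ sumIdx-cong (suc m) (λ x → cong₂ _*_
           (adj-permute G x (flip σ)) (colorWeight-permute β x σ)) ⟩
    sumIdx (suc m) (λ x → adj G x * colorWeight (λ l → β (σ ⟨$⟩ʳ l)) x) ∎
    where
    summand-cong : (λ x → adj G x * colorWeight β x) Preserves _≗_ ⟶ _≡_
    summand-cong {x} {y} x≗y = cong₂ _*_ (adj-cong G {x} {y} (image-cong x≗y))
                                 (prodFin-cong (λ l → cong (λ t → p t (β l)) (x≗y l)))

theorem6 : (m n k : ℕ) (G : Hypergraph (suc m) n) (f : Fin n → Fin k)
    → Surjective f
    → (S : (Fin (suc m) → Fin k) → ℚ)
    → IsParameterMatrix G f S
    → ∀ (α : Fin (suc m) → Fin k) (σ : Permutation′ (suc m))
    → NCompS (NMatrix f) S α ≡ NCompS (NMatrix f) S (λ i → α (σ ⟨$⟩ʳ i))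
theorem6 m n k G f _ S A∘P≡P∘S α σ = begin
  NCompS (NMatrix f) S α                   ≡⟨ NCompS≡adjContraction G f S A∘P≡P∘S α ⟩
  adjContraction G f α                     ≡⟨ adjContraction-permute G f α σ ⟩
  adjContraction G f (λ i → α (σ ⟨$⟩ʳ i))  ≡⟨ NCompS≡adjContraction G f S A∘P≡P∘S (λ i → α (σ ⟨$⟩ʳ i)) ⟨
  NCompS (NMatrix f) S (λ i → α (σ ⟨$⟩ʳ i)) ∎
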